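{- Let $(\mathcal X,\mathcal L)$ be a finite point-line geometry that is quasi-projective. Then $(\mathcal X,\mathcal L)$ is a geometry without lines, or a geometry in which every two distinct points lie on a singular line, or a geometry in which every point lies on a regular line.
   Context: A point-line geometry is a pair $(\mathcal X,\mathcal L)$ with $\mathcal X$ a nonempty finite set of points and $\mathcal L\subseteq\mathcal P(\mathcal X)$ a set of lines, such that every line contains at least two points and every two distinct points lie on at most one line. A line with exactly two points is singular; a line with more than two points is regular. A map $f:\mathcal X\to\mathcal Y$ is a homomorphism from $(\mathcal X,\mathcal L)$ to $(\mathcal Y,\mathcal K)$ if for every $l\in\mathcal L$ either $|f(l)|=1$ or there is $k\in\mathcal K$ with $f(l)\subseteq k$; an epimorphism is a surjective homomorphism. A geometry $\mathcal S$ is quasi-projective if for every point-line geometry $\mathcal T$, every homomorphism $f:\mathcal S\to\mathcal T$ and every epimorphism $j:\mathcal S\to\mathcal T$, there is an endomorphism $\phi$ of $\mathcal S$ with $j\circ\phi=f$. -}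

module Defs where

open import Data.Nat using (ℕ; _≤_)
open import Data.Fin using (Fin)
open import Data.Fin.Subset using (Subset; _∈_; ∣_∣)
open import Data.List using (List)
open import Data.List.Membership.Propositional using () renaming (_∈_ to _∈ₗ_)
open import Data.Product using (Σ; ∃; _×_)
open import Data.Sum using (_⊎_)
open import Relation.Binary.PropositionalEquality using (_≡_; _≢_)

record Geometry : Set where
  field
    n        : ℕ
    nonempty : 1 ≤ n
    lines    : List (Subset n)
    line≥2   : ∀ l → l ∈ₗ lines → 2 ≤ ∣ l ∣
    atMostOne : ∀ (x y : Fin n) → x ≢ y → ∀ l l' → l ∈ₗ lines → l' ∈ₗ lines →
                x ∈ l → y ∈ l → x ∈ l' → y ∈ l' → l ≡ l'

open Geometry public

Point : Geometry → Set
Point S = Fin (n S)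

IsHom : (S T : Geometry) → (Point S → Point T) → Set
IsHom S T f = ∀ l → l ∈ₗ lines S →
  (∀ x y → x ∈ l → y ∈ l → f x ≡ f y)
  ⊎ (Σ (Subset (n T)) λ k → k ∈ₗ lines T × (∀ x → x ∈ l → f x ∈ k))

IsEpi : (S T : Geometry) → (Point S → Point T) → Set
IsEpi S T j = IsHom S T j × (∀ y → ∃ λ x → j x ≡ y)

QuasiProjective : Geometry → Set
QuasiProjective S = ∀ (T : Geometry) (f j : Point S → Point T) →
  IsHom S T f → IsEpi S T j →
  Σ (Point S → Point S) λ φ → IsHom S S φ × (∀ x → j (φ x) ≡ f x)

WithoutLines : Geometry → Set
WithoutLines S = lines S ≡ Data.List.[]

EveryTwoOnSingular : Geometry → Set
EveryTwoOnSingular S = ∀ (x y : Point S) → x ≢ y →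
  Σ (Subset (n S)) λ l → l ∈ₗ lines S × x ∈ l × y ∈ l × ∣ l ∣ ≡ 2

EveryPointOnRegular : Geometry → Set
EveryPointOnRegular S = ∀ (x : Point S) →
  Σ (Subset (n S)) λ l → l ∈ₗ lines S × x ∈ l × 3 ≤ ∣ l ∣

-- Quasi-projectivity lets us prescribe endomorphisms: given a ≢ b and pairwise
-- distinct a′, b′, c′, lift the map sorting the points into {a}, {b} and the rest
-- through the corresponding epimorphism onto the three-point line; the lift φ has
-- φ a = a′, φ b = b′ and avoids a′, b′ elsewhere, so it maps every line through a
-- and b into a line through a′ and b′. If some line exists, sending two of its
-- points to any pair x ≢ y shows that x and y are collinear. If some point p is on
-- no regular line, a line with three points x, y, w is sent (x ↦ p, y ↦ x) into a
-- line through p, x and φ w, a regular line through p; so every line is singular.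
module Submission where

open import Defs
open import Data.Sum using (_⊎_; inj₁; inj₂)
open import Data.Nat using (ℕ; suc; _≤_; _<_; z≤n; s≤s)
open import Data.Nat.Properties using (≤-trans; ≤-antisym; <⇒≤; m≤n⇒m≤1+n; ≤-pred; ≰⇒>; _≤?_)
open import Data.Fin using (Fin; zero; suc; _≟_)
open import Data.Fin.Patterns using (0F; 1F; 2F)
open import Data.Fin.Properties using (all?; ¬∀⟶∃¬)
open import Data.Fin.Subset using (Subset; _∈_; _⊆_; ∣_∣; ⊤; _-_; Nonempty; inside; outside)
open import Data.Fin.Subset.Properties using (_∈?_; ∈⊤; drop-there; p⊆q⇒∣p∣≤∣q∣; p─q⊆p; x∈p∧x≢y⇒x∈p-y; x∈p⇒∣p-x∣<∣p∣)
open import Data.Vec using (_∷_; tail; here; there)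
open import Data.List using (List; []; _∷_)
open import Data.List.Relation.Unary.Any using (here; any?)
open import Data.List.Membership.Propositional using (find) renaming (_∈_ to _∈ₗ_)
open import Data.List.Membership.Propositional.Properties.Core using (∃∈-Any)
open import Data.Product using (∃; ∃₂; _×_; _,_)
open import Relation.Nullary using (¬_; Dec; yes; no; contradiction)
open import Relation.Nullary.Decidable using (_×-dec_; map′)
open import Relation.Unary using (Decidable)
open import Relation.Binary.PropositionalEquality using (_≡_; _≢_; refl; sym; trans; subst; subst₂; ≢-sym)

private
  variable
    m : ℕ

≡[]⊎∃∈ : ∀ {a} {A : Set a} (xs : List A) → xs ≡ [] ⊎ ∃ λ x → x ∈ₗ xs
≡[]⊎∃∈ []      = inj₁ refl
≡[]⊎∃∈ (x ∷ _) = inj₂ (x , here refl)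

∃∈? : ∀ {a p} {A : Set a} {P : A → Set p} → Decidable P →
  (xs : List A) → Dec (∃ λ x → x ∈ₗ xs × P x)
∃∈? P? xs = map′ find ∃∈-Any (any? P? xs)

p⊆tail[b∷p-0] : ∀ b (p : Subset m) → p ⊆ tail ((b ∷ p) - zero)
p⊆tail[b∷p-0] b p x∈p = drop-there (x∈p∧x≢y⇒x∈p-y {y = zero} (there {y = b} x∈p) λ ())

∣p∣≤1+∣p-x∣ : ∀ (p : Subset m) x → ∣ p ∣ ≤ suc ∣ p - x ∣
∣p∣≤1+∣p-x∣ (inside  ∷ p) zero    = s≤s (p⊆q⇒∣p∣≤∣q∣ (p⊆tail[b∷p-0] inside p))
∣p∣≤1+∣p-x∣ (outside ∷ p) zero    = m≤n⇒m≤1+n (p⊆q⇒∣p∣≤∣q∣ (p⊆tail[b∷p-0] outside p))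
∣p∣≤1+∣p-x∣ (inside  ∷ p) (suc x) = s≤s (∣p∣≤1+∣p-x∣ p x)
∣p∣≤1+∣p-x∣ (outside ∷ p) (suc x) = ∣p∣≤1+∣p-x∣ p x

x∈p-y⇒x≢y : ∀ {p : Subset m} {x y} → x ∈ p - y → x ≢ y
x∈p-y⇒x≢y {p = _ ∷ p} {suc x} (there x∈p-x) refl = x∈p-y⇒x≢y {p = p} x∈p-x refl

x∈p-y⇒x∈p : ∀ {p : Subset m} {x y} → x ∈ p - y → x ∈ p
x∈p-y⇒x∈p {p = p} = p─q⊆p p _

∣p∣>0⇒Nonempty : ∀ (p : Subset m) → 0 < ∣ p ∣ → Nonempty p
∣p∣>0⇒Nonempty (inside  ∷ p) _ = zero , here
∣p∣>0⇒Nonempty (outside ∷ p) ∣p∣>0 with ∣p∣>0⇒Nonempty p ∣p∣>0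
... | x , x∈p = suc x , there x∈p

∣p∣>1⇒∃∈p-x : ∀ (p : Subset m) → 2 ≤ ∣ p ∣ → ∀ x → ∃ λ z → z ∈ p × z ≢ x
∣p∣>1⇒∃∈p-x p 2≤∣p∣ x with ∣p∣>0⇒Nonempty (p - x) (≤-pred (≤-trans 2≤∣p∣ (∣p∣≤1+∣p-x∣ p x)))
... | z , z∈p-x = z , x∈p-y⇒x∈p z∈p-x , x∈p-y⇒x≢y z∈p-x

∣p∣>2⇒∃∈p-x-y : ∀ (p : Subset m) → 3 ≤ ∣ p ∣ → ∀ x y → ∃ λ z → z ∈ p × z ≢ x × z ≢ y
∣p∣>2⇒∃∈p-x-y p 3≤∣p∣ x y with ∣p∣>1⇒∃∈p-x (p - x) (≤-pred (≤-trans 3≤∣p∣ (∣p∣≤1+∣p-x∣ p x))) y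
... | z , z∈p-x , z≢y = z , x∈p-y⇒x∈p z∈p-x , x∈p-y⇒x≢y z∈p-x , z≢y

∣p∣>1⇒∃₂∈p : ∀ (p : Subset m) → 2 ≤ ∣ p ∣ → ∃₂ λ x y → x ∈ p × y ∈ p × x ≢ y
∣p∣>1⇒∃₂∈p p 2≤∣p∣ with ∣p∣>0⇒Nonempty p (<⇒≤ 2≤∣p∣)
... | x , x∈p with ∣p∣>1⇒∃∈p-x p 2≤∣p∣ x
... | y , y∈p , y≢x = x , y , x∈p , y∈p , ≢-sym y≢x

distinct-x,y,z∈p⇒∣p∣>2 : ∀ {p : Subset m} {x y z} → x ∈ p → y ∈ p → z ∈ p →
  x ≢ y → x ≢ z → y ≢ z → 3 ≤ ∣ p ∣
distinct-x,y,z∈p⇒∣p∣>2 {p = p} {x} {y} {z} x∈p y∈p z∈p x≢y x≢z y≢z =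
  ≤-trans (s≤s (≤-trans (s≤s (≤-trans (s≤s z≤n) (x∈p⇒∣p-x∣<∣p∣ z∈p-x-y)))
                        (x∈p⇒∣p-x∣<∣p∣ y∈p-x)))
          (x∈p⇒∣p-x∣<∣p∣ x∈p)
  where
  y∈p-x : y ∈ p - x
  y∈p-x = x∈p∧x≢y⇒x∈p-y y∈p (≢-sym x≢y)
  z∈p-x-y : z ∈ p - x - y
  z∈p-x-y = x∈p∧x≢y⇒x∈p-y (x∈p∧x≢y⇒x∈p-y z∈p (≢-sym x≢z)) (≢-sym y≢z)

OnRegularLine : (S : Geometry) → Point S → Set
OnRegularLine S x = ∃ λ l → l ∈ₗ lines S × x ∈ l × 3 ≤ ∣ l ∣

onRegularLine? : (S : Geometry) → Decidable (OnRegularLine S)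
onRegularLine? S x = ∃∈? (λ l → x ∈? l ×-dec 3 ≤? ∣ l ∣) (lines S)

Collinear : (S : Geometry) → Point S → Point S → Set
Collinear S x y = ∃ λ l → l ∈ₗ lines S × x ∈ l × y ∈ l

collinear? : (S : Geometry) → ∀ x y → Dec (Collinear S x y)
collinear? S x y = ∃∈? (λ l → x ∈? l ×-dec y ∈? l) (lines S)

isHom⇒lineImage : ∀ S T {f} → IsHom S T f → ∀ {l x y} → l ∈ₗ lines S →
  x ∈ l → y ∈ l → f x ≢ f y → ∃ λ k → k ∈ₗ lines T × (∀ z → z ∈ l → f z ∈ k)
isHom⇒lineImage S T f-hom {l} l∈ x∈l y∈l fx≢fy with f-hom l l∈
... | inj₁ collapsed = contradiction (collapsed _ _ x∈l y∈l) fx≢fy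
... | inj₂ image     = image

threePointLine : Geometry
threePointLine = record
  { n         = 3
  ; nonempty  = s≤s z≤n
  ; lines     = ⊤ ∷ []
  ; line≥2    = λ { _ (here refl) → s≤s (s≤s z≤n) }
  ; atMostOne = λ { _ _ _ _ _ (here refl) (here refl) _ _ _ _ → refl }
  }

isHom-threePointLine : ∀ S f → IsHom S threePointLine f
isHom-threePointLine S f _ _ = inj₂ (⊤ , here refl , λ _ _ → ∈⊤)

classify : Fin m → Fin m → Fin m → Fin 3
classify a b z with z ≟ a | z ≟ b
... | yes _ | _     = 0F
... | no _  | yes _ = 1F
... | no _  | no _  = 2F

classify-a : ∀ (a b : Fin m) → classify a b a ≡ 0F
classify-a a b with a ≟ a | a ≟ b
... | yes _   | _ = refl
... | no a≢a  | _ = contradiction refl a≢a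

classify-b : ∀ {a b : Fin m} → b ≢ a → classify a b b ≡ 1F
classify-b {a = a} {b} b≢a with b ≟ a | b ≟ b
... | yes b≡a | _       = contradiction b≡a b≢a
... | no _    | yes _   = refl
... | no _    | no b≢b  = contradiction refl b≢b

classify-other : ∀ {a b z : Fin m} → z ≢ a → z ≢ b → classify a b z ≡ 2F
classify-other {a = a} {b} {z} z≢a z≢b with z ≟ a | z ≟ b
... | yes z≡a | _       = contradiction z≡a z≢a
... | no _    | yes z≡b = contradiction z≡b z≢b
... | no _    | no _    = refl

classify≡0⇒≡a : ∀ {a b z : Fin m} → classify a b z ≡ 0F → z ≡ a
classify≡0⇒≡a {a = a} {b} {z} _ with z ≟ a | z ≟ b
classify≡0⇒≡a _  | yes z≡a | _     = z≡a
classify≡0⇒≡a () | no _    | yes _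
classify≡0⇒≡a () | no _    | no _

classify≡1⇒≡b : ∀ {a b z : Fin m} → classify a b z ≡ 1F → z ≡ b
classify≡1⇒≡b {a = a} {b} {z} _ with z ≟ a | z ≟ b
classify≡1⇒≡b () | yes _ | _
classify≡1⇒≡b _  | no _  | yes z≡b = z≡b
classify≡1⇒≡b () | no _  | no _

classify≡2⇒≢a,b : ∀ {a b z : Fin m} → classify a b z ≡ 2F → z ≢ a × z ≢ b
classify≡2⇒≢a,b {a = a} {b} {z} _ with z ≟ a | z ≟ b
classify≡2⇒≢a,b () | yes _ | _
classify≡2⇒≢a,b () | no _  | yes _
classify≡2⇒≢a,b _  | no z≢a | no z≢b = z≢a , z≢b

classify-surjective : ∀ {a b c : Fin m} → b ≢ a → c ≢ a → c ≢ b →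
  ∀ t → ∃ λ z → classify a b z ≡ t
classify-surjective {a = a} {b} _   _   _   0F = a , classify-a a b
classify-surjective {b = b}     b≢a _   _   1F = b , classify-b b≢a
classify-surjective {c = c}     _   c≢a c≢b 2F = c , classify-other c≢a c≢b

pointOffPair : ∀ (S : Geometry) {l x y} → l ∈ₗ lines S → ¬ Collinear S x y →
  ∃ λ c → c ≢ x × c ≢ y
pointOffPair S {l} {x} {y} l∈ ¬xy with x ∈? l
... | yes x∈l = let c , c∈l , c≢x = ∣p∣>1⇒∃∈p-x l (line≥2 S l l∈) x
                in c , c≢x , λ { refl → ¬xy (l , l∈ , x∈l , c∈l) }
... | no x∉l  = let c , c∈l , c≢y = ∣p∣>1⇒∃∈p-x l (line≥2 S l l∈) y
                in c , (λ { refl → x∉l c∈l }) , c≢y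

module QuasiProjectiveGeometry (S : Geometry) (qp : QuasiProjective S) where

  prescribedEndomorphism : ∀ {a b a′ b′ c′ : Point S} →
    a ≢ b → b′ ≢ a′ → c′ ≢ a′ → c′ ≢ b′ →
    ∃ λ φ → IsHom S S φ × φ a ≡ a′ × φ b ≡ b′ ×
            (∀ z → z ≢ a → z ≢ b → φ z ≢ a′ × φ z ≢ b′)
  prescribedEndomorphism {a} {b} {a′} {b′} a≢b b′≢a′ c′≢a′ c′≢b′ =
    let φ , φ-hom , lift = qp threePointLine (classify a b) (classify a′ b′)
                             (isHom-threePointLine S _)
                             (isHom-threePointLine S _ , classify-surjective b′≢a′ c′≢a′ c′≢b′)
    in φ , φ-hom
         , classify≡0⇒≡a (trans (lift a) (classify-a a b))
         , classify≡1⇒≡b (trans (lift b) (classify-b (≢-sym a≢b)))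
         , λ z z≢a z≢b → classify≡2⇒≢a,b (trans (lift z) (classify-other z≢a z≢b))

  lineExists⇒collinear : ∀ {l} → l ∈ₗ lines S → ∀ {x y} → x ≢ y → Collinear S x y
  lineExists⇒collinear {l} l∈ {x} {y} x≢y with collinear? S x y
  ... | yes xy = xy
  ... | no ¬xy =
    let u , v , u∈l , v∈l , u≢v         = ∣p∣>1⇒∃₂∈p l (line≥2 S l l∈)
        c , c≢x , c≢y                   = pointOffPair S l∈ ¬xy
        φ , φ-hom , φu≡x , φv≡y , _     = prescribedEndomorphism u≢v (≢-sym x≢y) c≢x c≢y
        k , k∈ , φl⊆k                   = isHom⇒lineImage S S φ-hom l∈ u∈l v∈l
                                            (subst₂ _≢_ (sym φu≡x) (sym φv≡y) x≢y)
    in contradiction (k , k∈ , subst (_∈ k) φu≡x (φl⊆k u u∈l) , subst (_∈ k) φv≡y (φl⊆k v v∈l)) ¬xy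

  offRegularPoint⇒¬regularLine : ∀ {p l} → ¬ OnRegularLine S p → l ∈ₗ lines S → ¬ 3 ≤ ∣ l ∣
  offRegularPoint⇒¬regularLine {p} {l} p-off l∈ 3≤∣l∣ =
    let x , y , x∈l , y∈l , x≢y               = ∣p∣>1⇒∃₂∈p l (<⇒≤ 3≤∣l∣)
        w , w∈l , w≢x , w≢y                   = ∣p∣>2⇒∃∈p-x-y l 3≤∣l∣ x y
        φ , φ-hom , φx≡p , φy≡x , φ-elsewhere = prescribedEndomorphism x≢y (≢p x∈l) (≢p w∈l) w≢x
        φw≢p , φw≢x                           = φ-elsewhere w w≢x w≢y
        k , k∈ , φl⊆k                         = isHom⇒lineImage S S φ-hom l∈ x∈l y∈l
                                                  (subst₂ _≢_ (sym φx≡p) (sym φy≡x) (≢-sym (≢p x∈l)))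
        p∈k                                   = subst (_∈ k) φx≡p (φl⊆k x x∈l)
        x∈k                                   = subst (_∈ k) φy≡x (φl⊆k y y∈l)
    in p-off (k , k∈ , p∈k , distinct-x,y,z∈p⇒∣p∣>2 p∈k x∈k (φl⊆k w w∈l)
                               (≢-sym (≢p x∈l)) (≢-sym φw≢p) (≢-sym φw≢x))
    where
    ≢p : ∀ {z} → z ∈ l → z ≢ p
    ≢p z∈l refl = p-off (l , l∈ , z∈l , 3≤∣l∣)

lemma6p1 : (S : Geometry) → QuasiProjective S →
    WithoutLines S ⊎ EveryTwoOnSingular S ⊎ EveryPointOnRegular S
lemma6p1 S qp with ≡[]⊎∃∈ (lines S) | all? (onRegularLine? S)
... | inj₁ noLines   | _       = inj₁ noLines
... | inj₂ _         | yes reg = inj₂ (inj₂ reg)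
... | inj₂ (_ , l₀∈) | no ¬reg = inj₂ (inj₁ λ x y x≢y →
  let p , p-off           = ¬∀⟶∃¬ _ _ (onRegularLine? S) ¬reg
      l , l∈ , x∈l , y∈l  = lineExists⇒collinear l₀∈ x≢y
      ∣l∣≤2               = ≤-pred (≰⇒> (offRegularPoint⇒¬regularLine p-off l∈))
  in l , l∈ , x∈l , y∈l , ≤-antisym ∣l∣≤2 (line≥2 S l l∈))
  where open QuasiProjectiveGeometry S qp
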